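{- Let $R : X\leftrightarrow\mathcal{P} Y$ range over multirelations. (1) If $R$ is inner univalent, then $\delta_i(R)\subseteq R$ and $R\sqsubseteq_\uparrow\delta_i(R)$. (2) If $R\sqsubseteq_\downarrow\delta_i(R)$, then $R$ is inner univalent. Moreover, $R\sqsubseteq_\updownarrow\delta_i(R)$ holds iff $R\sqsubseteq_\downarrow\delta_i(R)$. (3) $R$ is inner total iff $\delta_i(R)\sqsubseteq_\uparrow R$. Moreover, $\delta_i(R)\sqsubseteq_\updownarrow R$ holds iff $\delta_i(R)\sqsubseteq_\uparrow R$. (4) If $R\subseteq\delta_i(R)$, then $R$ is inner deterministic.
   Context: Multirelations are subsets of $X\times\mathcal{P} Y$. $R$ is inner total if $B\neq\emptyset$ for all $(a,B)\in R$; inner univalent if each such $B$ is empty or a singleton; inner deterministic if each such $B$ is a singleton. $\delta_i(R) = \{(a,\{b\})\mid\exists B.\ (a,B)\in R\wedge b\in B\}$. Up-closure ${\uparrow}R = \{(a,A)\mid\exists B.\ (a,B)\in R\wedge B\subseteq A\}$, down-closure ${\downarrow}R = \{(a,A)\mid\exists B.\ (a,B)\in R\wedge A\subseteq B\}$. Smyth preorder $R\sqsubseteq_\uparrow S\Leftrightarrow S\subseteq{\uparrow}R$; Hoare preorder $R\sqsubseteq_\downarrow S\Leftrightarrow R\subseteq{\downarrow}S$; Egli-Milner $R\sqsubseteq_\updownarrow S\Leftrightarrow R\sqsubseteq_\downarrow S\wedge R\sqsubseteq_\uparrow S$. -}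

module Defs where

open import Level using (Level; suc; _⊔_)
open import Data.Product using (Σ; ∃; ∃-syntax; _×_; _,_)
open import Data.Sum using (_⊎_)
open import Relation.Nullary using (¬_)
open import Relation.Binary.PropositionalEquality using (_≡_)

𝒫 : Set → Set₁
𝒫 Y = Y → Set

_⊆ₛ_ : {Y : Set} → 𝒫 Y → 𝒫 Y → Set
B ⊆ₛ A = ∀ y → B y → A y

_≐_ : {Y : Set} → 𝒫 Y → 𝒫 Y → Set
A ≐ B = A ⊆ₛ B × B ⊆ₛ A

Empty : {Y : Set} → 𝒫 Y → Set
Empty B = ∀ y → ¬ B y

｛_｝ : {Y : Set} → Y → 𝒫 Y
｛ b ｝ = λ y → b ≡ y

IsSingleton : {Y : Set} → 𝒫 Y → Set
IsSingleton {Y} B = ∃[ b ] (B ≐ ｛ b ｝)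

MRel : Set → Set → Set₂
MRel X Y = X → 𝒫 Y → Set₁

-- A multirelation is a set of pairs (a , B); since subsets are extensional
-- in set theory, we require membership to respect extensional equality of B.
Extensional : {X Y : Set} → MRel X Y → Set₁
Extensional {X} {Y} R = ∀ (a : X) (A B : 𝒫 Y) → A ≐ B → R a A → R a B

_⊆ᵣ_ : {X Y : Set} → MRel X Y → MRel X Y → Set₁
R ⊆ᵣ S = ∀ a A → R a A → S a A

InnerTotal : {X Y : Set} → MRel X Y → Set₁
InnerTotal R = ∀ a B → R a B → ¬ Empty B

InnerUnivalent : {X Y : Set} → MRel X Y → Set₁
InnerUnivalent R = ∀ a B → R a B → Empty B ⊎ IsSingleton B

InnerDeterministic : {X Y : Set} → MRel X Y → Set₁
InnerDeterministic R = ∀ a B → R a B → IsSingleton B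

-- δᵢ(R) = {(a,{b}) | ∃ B. (a,B) ∈ R ∧ b ∈ B}  (A ranges over sets equal to {b})
δᵢ : {X Y : Set} → MRel X Y → MRel X Y
δᵢ R a A = ∃[ B ] ∃[ b ] (R a B × B b × A ≐ ｛ b ｝)

↑ : {X Y : Set} → MRel X Y → MRel X Y
↑ R a A = ∃[ B ] (R a B × B ⊆ₛ A)

↓ : {X Y : Set} → MRel X Y → MRel X Y
↓ R a A = ∃[ B ] (R a B × A ⊆ₛ B)

_⊑↑_ : {X Y : Set} → MRel X Y → MRel X Y → Set₁
R ⊑↑ S = S ⊆ᵣ ↑ R

_⊑↓_ : {X Y : Set} → MRel X Y → MRel X Y → Set₁
R ⊑↓ S = R ⊆ᵣ ↓ S

_⊑↕_ : {X Y : Set} → MRel X Y → MRel X Y → Set₁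
R ⊑↕ S = R ⊑↓ S × R ⊑↑ S

{-# OPTIONS --safe #-}
-- Everything reduces to two facts about δᵢ R: it is inner deterministic, and
-- each of its members {b} lies below a member B ∋ b of R.  Inner univalence of
-- R is then inherited from anything it lies Hoare-below that is inner
-- deterministic, inner totality is inherited along the Smyth order, and when R
-- is inner univalent every member {b} of δᵢ R is (extensionally) the member B
-- of R it came from.  Excluded middle is needed only to decide whether a
-- subset of a singleton is empty and to extract an element of a nonempty set.
module Submission where

open import Defs
open import Level using (0ℓ)
open import Axiom.ExcludedMiddle using (ExcludedMiddle)
open import Data.Empty using (⊥-elim)
open import Data.Product using (_×_; _,_; proj₁; proj₂; ∃)
open import Data.Sum using (_⊎_; inj₁; inj₂)
open import Function.Bundles using (_⇔_; mk⇔)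
open import Relation.Nullary using (¬_; yes; no)
open import Relation.Binary.PropositionalEquality using (refl; sym; trans; subst)

private variable
  X Y : Set

≐-refl : {A : 𝒫 Y} → A ≐ A
≐-refl = (λ _ z → z) , (λ _ z → z)

≐-sym : {A B : 𝒫 Y} → A ≐ B → B ≐ A
≐-sym (A⊆B , B⊆A) = B⊆A , A⊆B

≐-trans : {A B C : 𝒫 Y} → A ≐ B → B ≐ C → A ≐ C
≐-trans (A⊆B , B⊆A) (B⊆C , C⊆B) = (λ y z → B⊆C y (A⊆B y z)) , (λ y z → B⊆A y (C⊆B y z))

IsSingleton⇒≐｛member｝ : {B : 𝒫 Y} {b : Y} → IsSingleton B → B b → B ≐ ｛ b ｝
IsSingleton⇒≐｛member｝ (c , B⊆c , c⊆B) Bb =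
  (λ y By → trans (sym (B⊆c _ Bb)) (B⊆c y By)) , (λ { y refl → Bb })

IsSingleton⇒¬Empty : {B : 𝒫 Y} → IsSingleton B → ¬ Empty B
IsSingleton⇒¬Empty (c , _ , c⊆B) empty = empty c (c⊆B c refl)

⊆｛｝⇒Empty⊎IsSingleton : ExcludedMiddle 0ℓ → {B : 𝒫 Y} {b : Y} →
  B ⊆ₛ ｛ b ｝ → Empty B ⊎ IsSingleton B
⊆｛｝⇒Empty⊎IsSingleton em {B} {b} B⊆b with em {B b}
... | yes Bb = inj₂ (b , B⊆b , λ { y refl → Bb })
... | no ¬Bb = inj₁ (λ y By → ¬Bb (subst B (sym (B⊆b y By)) By))

¬Empty⇒inhabited : ExcludedMiddle 0ℓ → {B : 𝒫 Y} → ¬ Empty B → ∃ B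
¬Empty⇒inhabited em {B} nonempty with em {∃ B}
... | yes inhabited = inhabited
... | no ¬inhabited = ⊥-elim (nonempty (λ y By → ¬inhabited (y , By)))

module _ {R S : MRel X Y} where

  ⊆ᵣ⇒⊑↑ : S ⊆ᵣ R → R ⊑↑ S
  ⊆ᵣ⇒⊑↑ S⊆R a A SaA = A , S⊆R a A SaA , (λ _ z → z)

  ⊆ᵣ-innerDeterministic : R ⊆ᵣ S → InnerDeterministic S → InnerDeterministic R
  ⊆ᵣ-innerDeterministic R⊆S det a B RaB = det a B (R⊆S a B RaB)

  ⊑↑-innerTotal : R ⊑↑ S → InnerTotal R → InnerTotal S
  ⊑↑-innerTotal S⊆↑R total a A SaA emptyA with S⊆↑R a A SaA
  ... | B , RaB , B⊆A = total a B RaB (λ y By → emptyA y (B⊆A y By))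

  ⊑↓-innerUnivalent : ExcludedMiddle 0ℓ → R ⊑↓ S → InnerDeterministic S → InnerUnivalent R
  ⊑↓-innerUnivalent em R⊆↓S det a B RaB with R⊆↓S a B RaB
  ... | C , SaC , B⊆C with det a C SaC
  ...   | c , C⊆c , _ = ⊆｛｝⇒Empty⊎IsSingleton em (λ y By → C⊆c y (B⊆C y By))

  ⊑↕⇔⊑↓ : (R ⊑↓ S → R ⊑↑ S) → (R ⊑↕ S) ⇔ (R ⊑↓ S)
  ⊑↕⇔⊑↓ ↓⇒↑ = mk⇔ proj₁ (λ R⊑↓S → R⊑↓S , ↓⇒↑ R⊑↓S)

  ⊑↕⇔⊑↑ : R ⊑↓ S → (R ⊑↕ S) ⇔ (R ⊑↑ S)
  ⊑↕⇔⊑↑ R⊑↓S = mk⇔ proj₂ (R⊑↓S ,_)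

module _ {R : MRel X Y} where

  δᵢ-innerDeterministic : InnerDeterministic (δᵢ R)
  δᵢ-innerDeterministic a A (_ , b , _ , _ , A≐b) = b , A≐b

  δᵢ-⊑↓ : δᵢ R ⊑↓ R
  δᵢ-⊑↓ a A (B , b , RaB , Bb , A≐b) = B , RaB , λ y Ay → subst B (proj₁ A≐b y Ay) Bb

  δᵢ-⊆-innerUnivalent : Extensional R → InnerUnivalent R → δᵢ R ⊆ᵣ R
  δᵢ-⊆-innerUnivalent ext univ a A (B , b , RaB , Bb , A≐b) with univ a B RaB
  ... | inj₁ emptyB = ⊥-elim (emptyB b Bb)
  ... | inj₂ singleB = ext a B A (≐-trans (IsSingleton⇒≐｛member｝ singleB Bb) (≐-sym A≐b)) RaB

  innerTotal⇒δᵢ-⊑↑ : ExcludedMiddle 0ℓ → InnerTotal R → δᵢ R ⊑↑ R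
  innerTotal⇒δᵢ-⊑↑ em total a B RaB with ¬Empty⇒inhabited em (total a B RaB)
  ... | b , Bb = ｛ b ｝ , (B , b , RaB , Bb , ≐-refl) , λ { y refl → Bb }

  δᵢ-⊑↑⇒innerTotal : δᵢ R ⊑↑ R → InnerTotal R
  δᵢ-⊑↑⇒innerTotal δᵢR⊑↑R =
    ⊑↑-innerTotal δᵢR⊑↑R (λ a A δᵢRaA → IsSingleton⇒¬Empty (δᵢ-innerDeterministic a A δᵢRaA))

lemma5p2 : ExcludedMiddle 0ℓ → {X Y : Set} (R : MRel X Y) → Extensional R →
    (InnerUnivalent R → (δᵢ R ⊆ᵣ R) × (R ⊑↑ δᵢ R))
    × ((R ⊑↓ δᵢ R → InnerUnivalent R) × ((R ⊑↕ δᵢ R) ⇔ (R ⊑↓ δᵢ R)))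
    × ((InnerTotal R ⇔ (δᵢ R ⊑↑ R)) × ((δᵢ R ⊑↕ R) ⇔ (δᵢ R ⊑↑ R)))
    × (R ⊆ᵣ δᵢ R → InnerDeterministic R)
lemma5p2 em R ext =
  (λ univ → δᵢR⊆R univ , ⊆ᵣ⇒⊑↑ (δᵢR⊆R univ))
  , (univalent , ⊑↕⇔⊑↓ (λ R⊑↓δᵢR → ⊆ᵣ⇒⊑↑ (δᵢR⊆R (univalent R⊑↓δᵢR))))
  , (mk⇔ (innerTotal⇒δᵢ-⊑↑ em) δᵢ-⊑↑⇒innerTotal , ⊑↕⇔⊑↑ δᵢ-⊑↓)
  , (λ R⊆δᵢR → ⊆ᵣ-innerDeterministic R⊆δᵢR δᵢ-innerDeterministic)
  where
  δᵢR⊆R : InnerUnivalent R → δᵢ R ⊆ᵣ R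
  δᵢR⊆R = δᵢ-⊆-innerUnivalent ext

  univalent : R ⊑↓ δᵢ R → InnerUnivalent R
  univalent R⊑↓δᵢR = ⊑↓-innerUnivalent em R⊑↓δᵢR δᵢ-innerDeterministic
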